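{- Let $k \geq 1$, let $p_1 < p_2 < \dots < p_k$ be the first $k$ prime numbers and $P_k = \prod_{i=1}^k p_i$. Let $r_1, \ldots, r_k$ be arbitrary integers (a residue class $r_i$ modulo $p_i$ for each $i$), and for $1 \le n \le P_k$ let $\gamma(n) = \#\{ i \in \{1,\dots,k\} : n \equiv r_i \pmod{p_i}\}$. Then, for every such choice of $r_1,\dots,r_k$, $$\#\{ n \in \{1,\dots,P_k\} : \gamma(n) \le 1\} = a_k \quad\text{and}\quad \#\{ n \in \{1,\dots,P_k\} : \gamma(n) = 0\} = f_k,$$ where $a_k$ is the determinant of the $k\times k$ matrix with diagonal entries $p_1,\dots,p_k$ and all off-diagonal entries equal to $1$, and $f_k = (-1)^k \det M_k$, where $M_k$ is the $(k+1)\times(k+1)$ matrix whose first row consists entirely of ones and, for $1 \le i \le k$, whose row $i+1$ has entry $p_i$ in column $i$ and entry $1$ in every other column (so in particular the last column consists entirely of ones).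
   Context: Integers $n$ with $\gamma(n)\le 1$ are called available and those with $\gamma(n)=0$ are called free. -}

module Defs where

open import Data.Nat as ℕ using (ℕ; zero; suc; _<_; _≤_)
open import Data.Nat.Primality using (Prime)
import Data.Nat.Divisibility as ℕD
open import Data.Integer as ℤ using (ℤ; +_; _-_; _*_; -_)
open import Data.Integer.Divisibility using (_∣_)
open import Data.Fin using (Fin; zero; suc; punchIn; inject₁; fromℕ; toℕ)
open import Data.Product using (∃; _×_)
open import Data.Bool using (Bool; true; false; if_then_else_)
open import Relation.Nullary using (Dec; yes; no; does)
open import Relation.Binary.PropositionalEquality using (_≡_)

Matrix : ℕ → Set
Matrix n = Fin n → Fin n → ℤ

∑ : ∀ n → (Fin n → ℤ) → ℤ
∑ zero    f = + 0
∑ (suc n) f = f zero ℤ.+ ∑ n (λ i → f (suc i))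

sign : ℕ → ℤ
sign zero    = + 1
sign (suc m) = - sign m

minor : ∀ {n} → Matrix (suc n) → Fin (suc n) → Matrix n
minor M j a b = M (suc a) (punchIn j b)

det : ∀ n → Matrix n → ℤ
det zero    M = + 1
det (suc n) M = ∑ (suc n) (λ j → sign (toℕ j) * (M zero j * det n (minor M j)))

FirstPrimes : ∀ k → (Fin k → ℕ) → Set
FirstPrimes k p =
  (∀ i → Prime (p i)) ×
  (∀ i j → toℕ i < toℕ j → p i < p j) ×
  (∀ i q → Prime q → q < p i → ∃ λ j → p j ≡ q)

prodFin : ∀ k → (Fin k → ℕ) → ℕ
prodFin zero    p = 1
prodFin (suc k) p = p zero ℕ.* prodFin k (λ i → p (suc i))

_≡_[mod_] : ℤ → ℤ → ℕ → Set
a ≡ b [mod m ] = (+ m) ∣ (a - b)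

_≡?_[mod_] : ∀ a b m → Dec (a ≡ b [mod m ])
a ≡? b [mod m ] = m ℕD.∣? ℤ.∣ a - b ∣

countFin : ∀ k {P : Fin k → Set} → (∀ i → Dec (P i)) → ℕ
countFin zero    d = 0
countFin (suc k) d =
  (if does (d zero) then 1 else 0) ℕ.+ countFin k (λ i → d (suc i))

countRange : ∀ (N : ℕ) {P : ℕ → Set} → (∀ n → Dec (P n)) → ℕ
countRange zero    d = 0
countRange (suc N) d =
  (if does (d (suc N)) then 1 else 0) ℕ.+ countRange N d

γ : ∀ k → (Fin k → ℕ) → (Fin k → ℤ) → ℕ → ℕ
γ k p r n = countFin k (λ i → (+ n) ≡? r i [mod p i ])

AMat : ∀ k → (Fin k → ℕ) → Matrix k
AMat k p i j with i Data.Fin.≟ j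
... | yes _ = + p i
... | no  _ = + 1

-- The (k+1)×(k+1) matrix M_k: first row all ones; row i+1 has p_i in
-- column i (0-based: column inject₁ i) and 1 elsewhere.
MMat : ∀ k → (Fin k → ℕ) → Matrix (suc k)
MMat k p zero    j = + 1
MMat k p (suc i) j with inject₁ i Data.Fin.≟ j
... | yes _ = + p i
... | no  _ = + 1

aₖ : ∀ k → (Fin k → ℕ) → ℤ
aₖ k p = det k (AMat k p)

fₖ : ∀ k → (Fin k → ℕ) → ℤ
fₖ k p = sign k * det (suc k) (MMat k p)

-- If m₀ is coprime to b = m₁ ⋯ mₖ₋₁, the numbers below m₀ b fall
-- into the b fibres {y + s b : s < m₀}; on a fibre the later moduli all see the same residue, and by
-- the Chinese remainder theorem exactly one s puts y + s b into the class r₀ mod m₀. So with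
-- uᵢ = mᵢ − 1 the free numbers satisfy F = u₀ F′ and the available ones A = F′ + u₀ A′, whence
-- F = ∏ uᵢ and A = eₖ(u) + eₖ₋₁(u). The determinants obey the same recursions: write the rows as
-- 𝟙 + uᵢ δᵢ and expand multilinearly; every term containing 𝟙 twice has two equal rows and vanishes.
module Submission where

open import Defs
open import Data.Nat as ℕ using (ℕ; zero; suc; _≤_; _≤?_; _≟_)
open import Data.Nat.Primality using (prime⇒nonZero)
open import Data.Nat.Coprimality using (prime⇒coprime)
import Data.Nat.Coprimality as Coprime
open import Data.Integer using (ℤ; +_)
import Data.Integer as ℤ
open import Data.Fin as F using (Fin; zero; suc; toℕ; punchIn; inject₁)
open import Data.Bool using (true; false; if_then_else_)
open import Data.Product using (∃; _×_; _,_; proj₁; proj₂)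
open import Data.Sum using (inj₁; inj₂)
open import Function using (_∘_; _⇔_; mk⇔)
open import Relation.Nullary using (Dec; does; yes; no; ¬_; contradiction)
open import Relation.Nullary.Decidable using (does-⇔)
open import Relation.Binary.PropositionalEquality
open ≡-Reasoning

∏ : ∀ k → (Fin k → ℤ) → ℤ
∏ zero    u = + 1
∏ (suc k) u = u zero ℤ.* ∏ k (u ∘ suc)

-- eₖ(u) + eₖ₋₁(u), the sum of the top two elementary symmetric polynomials in u₀ … uₖ₋₁.
symTop : ∀ k → (Fin k → ℤ) → ℤ
symTop zero    u = + 1
symTop (suc k) u = u zero ℤ.* symTop k (u ∘ suc) ℤ.+ ∏ k (u ∘ suc)

module DeterminantFormulas where

  open import Data.Integer using (-[1+_]; _+_; _*_; -_; _-_)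
  open import Data.Integer.Properties
    using (*-zeroʳ; *-identityˡ; +-identityˡ; +-identityʳ; *-distribˡ-+; neg-distrib-+; *-assoc;
           +-commutativeSemigroup)
  open import Algebra.Properties.CommutativeSemigroup +-commutativeSemigroup using (interchange; x∙yz≈y∙xz)
  open import Data.Integer.Tactic.RingSolver using (solve-∀)
  open import Data.Vec.Functional using (_∷_)

  ∑-cong : ∀ n {f g : Fin n → ℤ} → (∀ i → f i ≡ g i) → ∑ n f ≡ ∑ n g
  ∑-cong zero    f≗g = refl
  ∑-cong (suc n) f≗g = cong₂ _+_ (f≗g zero) (∑-cong n (f≗g ∘ suc))

  ∑-+ : ∀ n (f g : Fin n → ℤ) → ∑ n (λ i → f i + g i) ≡ ∑ n f + ∑ n g
  ∑-+ zero    f g = refl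
  ∑-+ (suc n) f g = begin
    (f zero + g zero) + ∑ n (λ i → f (suc i) + g (suc i))
      ≡⟨ cong (_+_ (f zero + g zero)) (∑-+ n (f ∘ suc) (g ∘ suc)) ⟩
    (f zero + g zero) + (∑ n (f ∘ suc) + ∑ n (g ∘ suc))
      ≡⟨ interchange (f zero) (g zero) (∑ n (f ∘ suc)) (∑ n (g ∘ suc)) ⟩
    (f zero + ∑ n (f ∘ suc)) + (g zero + ∑ n (g ∘ suc)) ∎

  ∑-distribˡ : ∀ n c (f : Fin n → ℤ) → ∑ n (λ i → c * f i) ≡ c * ∑ n f
  ∑-distribˡ zero    c f = sym (*-zeroʳ c)
  ∑-distribˡ (suc n) c f =
    trans (cong (_+_ (c * f zero)) (∑-distribˡ n c (f ∘ suc))) (sym (*-distribˡ-+ c _ _))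

  ∑-neg : ∀ n (f : Fin n → ℤ) → ∑ n (λ i → - f i) ≡ - ∑ n f
  ∑-neg zero    f = refl
  ∑-neg (suc n) f =
    trans (cong (_+_ (- f zero)) (∑-neg n (f ∘ suc))) (sym (neg-distrib-+ (f zero) _))

  ∑-zero : ∀ n → ∑ n (λ _ → + 0) ≡ + 0
  ∑-zero zero    = refl
  ∑-zero (suc n) = trans (+-identityˡ _) (∑-zero n)

  δ : ∀ {n} → Fin n → Fin n → ℤ
  δ i j = if does (i F.≟ j) then + 1 else + 0

  ∑-δ : ∀ n (c : Fin n) (g : Fin n → ℤ) → ∑ n (λ j → δ c j * g j) ≡ g c
  ∑-δ (suc n) zero    g = begin
    + 1 * g zero + ∑ n (λ j → + 0 * g (suc j))  ≡⟨ cong₂ _+_ (*-identityˡ (g zero)) (∑-cong n (λ _ → refl)) ⟩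
    g zero + ∑ n (λ _ → + 0)                     ≡⟨ cong (_+_ (g zero)) (∑-zero n) ⟩
    g zero + + 0                                  ≡⟨ +-identityʳ (g zero) ⟩
    g zero                                        ∎
  ∑-δ (suc n) (suc c) g = trans (+-identityˡ _) (∑-δ n c (g ∘ suc))

  det-cong : ∀ n {M N : Matrix n} → (∀ i j → M i j ≡ N i j) → det n M ≡ det n N
  det-cong zero    M≗N = refl
  det-cong (suc n) M≗N = ∑-cong (suc n) λ j →
    cong₂ (λ a d → sign (toℕ j) * (a * d)) (M≗N zero j) (det-cong n (λ a b → M≗N (suc a) (punchIn j b)))

  det-linear-row₀ : ∀ n (x y : Fin (suc n) → ℤ) u (N : Fin n → Fin (suc n) → ℤ) →
    det (suc n) ((λ j → x j + u * y j) ∷ N) ≡ det (suc n) (x ∷ N) + u * det (suc n) (y ∷ N)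
  det-linear-row₀ n x y u N = begin
    ∑ (suc n) (λ j → s j * ((x j + u * y j) * D j))
      ≡⟨ ∑-cong (suc n) (λ j → expand (s j) (x j) u (y j) (D j)) ⟩
    ∑ (suc n) (λ j → s j * (x j * D j) + u * (s j * (y j * D j)))
      ≡⟨ ∑-+ (suc n) (λ j → s j * (x j * D j)) (λ j → u * (s j * (y j * D j))) ⟩
    det (suc n) (x ∷ N) + ∑ (suc n) (λ j → u * (s j * (y j * D j)))
      ≡⟨ cong (_+_ (det (suc n) (x ∷ N))) (∑-distribˡ (suc n) u (λ j → s j * (y j * D j))) ⟩
    det (suc n) (x ∷ N) + u * det (suc n) (y ∷ N) ∎
    where
    s D : Fin (suc n) → ℤ
    s j = sign (toℕ j)
    D j = det n (minor (x ∷ N) j)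
    expand : ∀ s x u y d → s * ((x + u * y) * d) ≡ s * (x * d) + u * (s * (y * d))
    expand = solve-∀

  det-linear-row₁ : ∀ n (w x y : Fin (suc (suc n)) → ℤ) u (N : Fin n → Fin (suc (suc n)) → ℤ) →
    det (suc (suc n)) (w ∷ (λ j → x j + u * y j) ∷ N) ≡
    det (suc (suc n)) (w ∷ x ∷ N) + u * det (suc (suc n)) (w ∷ y ∷ N)
  det-linear-row₁ n w x y u N = begin
    ∑ (suc (suc n)) (λ j → s j * (w j * det (suc n) (minor (w ∷ (λ j → x j + u * y j) ∷ N) j)))
      ≡⟨ ∑-cong (suc (suc n)) (λ j → trans
           (cong (λ d → s j * (w j * d))
                 (det-linear-row₀ n (x ∘ punchIn j) (y ∘ punchIn j) u (λ a b → N a (punchIn j b))))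
           (expand (s j) (w j) (Dx j) u (Dy j))) ⟩
    ∑ (suc (suc n)) (λ j → s j * (w j * Dx j) + u * (s j * (w j * Dy j)))
      ≡⟨ ∑-+ (suc (suc n)) (λ j → s j * (w j * Dx j)) (λ j → u * (s j * (w j * Dy j))) ⟩
    det (suc (suc n)) (w ∷ x ∷ N) + ∑ (suc (suc n)) (λ j → u * (s j * (w j * Dy j)))
      ≡⟨ cong (_+_ (det (suc (suc n)) (w ∷ x ∷ N))) (∑-distribˡ (suc (suc n)) u (λ j → s j * (w j * Dy j))) ⟩
    det (suc (suc n)) (w ∷ x ∷ N) + u * det (suc (suc n)) (w ∷ y ∷ N) ∎
    where
    s Dx Dy : Fin (suc (suc n)) → ℤ
    s j = sign (toℕ j)
    Dx j = det (suc n) (minor (w ∷ x ∷ N) j)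
    Dy j = det (suc n) (minor (w ∷ y ∷ N) j)
    expand : ∀ s a b u c → s * (a * (b + u * c)) ≡ s * (a * b) + u * (s * (a * c))
    expand = solve-∀

  det-unit-row₀ : ∀ n (c : Fin (suc n)) (N : Fin n → Fin (suc n) → ℤ) →
    det (suc n) (δ c ∷ N) ≡ sign (toℕ c) * det n (minor (δ c ∷ N) c)
  det-unit-row₀ n c N =
    trans (∑-cong (suc n) (λ j → reorder (sign (toℕ j)) (δ c j) (det n (minor (δ c ∷ N) j))))
          (∑-δ (suc n) c (λ j → sign (toℕ j) * det n (minor (δ c ∷ N) j)))
    where
    reorder : ∀ s a d → s * (a * d) ≡ a * (s * d)
    reorder = solve-∀

  -- (j , l) ↦ (punchIn j l , swapIndex j l) exchanges the column deleted by the first row of a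
  -- Laplace expansion with the one deleted by the second row.
  swapIndex : ∀ {n} → Fin (suc (suc n)) → Fin (suc n) → Fin (suc n)
  swapIndex zero    l       = zero
  swapIndex (suc c) zero    = c
  swapIndex {suc n} (suc c) (suc l) = suc (swapIndex c l)

  punchIn-swapIndex : ∀ {n} (c : Fin (suc (suc n))) l → punchIn (punchIn c l) (swapIndex c l) ≡ c
  punchIn-swapIndex zero    l       = refl
  punchIn-swapIndex (suc c) zero    = refl
  punchIn-swapIndex {suc n} (suc c) (suc l) = cong suc (punchIn-swapIndex c l)

  punchIn²-swapIndex : ∀ {n} (c : Fin (suc (suc n))) l (y : Fin n) →
    punchIn (punchIn c l) (punchIn (swapIndex c l) y) ≡ punchIn c (punchIn l y)
  punchIn²-swapIndex zero    l       y       = refl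
  punchIn²-swapIndex (suc c) zero    y       = refl
  punchIn²-swapIndex {suc n} (suc c) (suc l) zero    = refl
  punchIn²-swapIndex {suc n} (suc c) (suc l) (suc y) = cong suc (punchIn²-swapIndex c l y)

  sign-swapIndex : ∀ {n} (c : Fin (suc (suc n))) l →
    sign (toℕ (punchIn c l)) * sign (toℕ (swapIndex c l)) ≡ - (sign (toℕ c) * sign (toℕ l))
  sign-swapIndex zero    l       = lemma (sign (toℕ l))
    where
    lemma : ∀ a → - a * + 1 ≡ - (+ 1 * a)
    lemma = solve-∀
  sign-swapIndex (suc c) zero    = lemma (sign (toℕ c))
    where
    lemma : ∀ a → + 1 * a ≡ - (- a * + 1)
    lemma = solve-∀
  sign-swapIndex {suc n} (suc c) (suc l) = begin
    - s (punchIn c l) * - s (swapIndex c l) ≡⟨ neg*neg (s (punchIn c l)) (s (swapIndex c l)) ⟩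
    s (punchIn c l) * s (swapIndex c l)     ≡⟨ sign-swapIndex c l ⟩
    - (s c * s l)                           ≡⟨ cong -_ (sym (neg*neg (s c) (s l))) ⟩
    - (- s c * - s l)                       ∎
    where
    s : ∀ {m} → Fin m → ℤ
    s j = sign (toℕ j)
    neg*neg : ∀ a b → - a * - b ≡ a * b
    neg*neg = solve-∀

  ∑∑-swapIndex : ∀ n (G : Fin (suc (suc n)) → Fin (suc n) → ℤ) →
    ∑ (suc (suc n)) (λ j → ∑ (suc n) (G j)) ≡
    ∑ (suc (suc n)) (λ c → ∑ (suc n) (λ l → G (punchIn c l) (swapIndex c l)))
  ∑∑-swapIndex zero G = lemma (G zero zero) (G (suc zero) zero)
    where
    lemma : ∀ a b → (a + + 0) + ((b + + 0) + + 0) ≡ (b + + 0) + ((a + + 0) + + 0)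
    lemma = solve-∀
  ∑∑-swapIndex (suc m) G = begin
    ∑ (suc (suc (suc m))) (λ j → ∑ (suc (suc m)) (G j))
      ≡⟨ cong (_+_ A) (∑-+ (suc (suc m)) (λ j → G (suc j) zero) (λ j → ∑ (suc m) (G′ j))) ⟩
    A + (B + ∑ (suc (suc m)) (λ j → ∑ (suc m) (G′ j)))
      ≡⟨ cong (λ x → A + (B + x)) (∑∑-swapIndex m G′) ⟩
    A + (B + C)
      ≡⟨ x∙yz≈y∙xz A B C ⟩
    B + (A + C)
      ≡⟨ cong (_+_ B) (sym (∑-+ (suc (suc m)) (G zero) H)) ⟩
    ∑ (suc (suc (suc m))) (λ c → ∑ (suc (suc m)) (λ l → G (punchIn c l) (swapIndex c l))) ∎
    where
    G′ : Fin (suc (suc m)) → Fin (suc m) → ℤ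
    G′ j l = G (suc j) (suc l)
    H : Fin (suc (suc m)) → ℤ
    H c = ∑ (suc m) (λ l → G′ (punchIn c l) (swapIndex c l))
    A B C : ℤ
    A = ∑ (suc (suc m)) (G zero)
    B = ∑ (suc (suc m)) (λ j → G (suc j) zero)
    C = ∑ (suc (suc m)) H

  x≡-x⇒x≡0 : ∀ x → x ≡ - x → x ≡ + 0
  x≡-x⇒x≡0 (+ zero)   _  = refl
  x≡-x⇒x≡0 (+ suc n)  ()
  x≡-x⇒x≡0 -[1+ n ]   ()

  det-repeated-row : ∀ n (x : Fin (suc (suc n)) → ℤ) (N : Fin n → Fin (suc (suc n)) → ℤ) →
    det (suc (suc n)) (x ∷ x ∷ N) ≡ + 0
  det-repeated-row n x N = x≡-x⇒x≡0 _ (begin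
    det (suc (suc n)) (x ∷ x ∷ N)
      ≡⟨ expand ⟩
    ∑ (suc (suc n)) (λ j → ∑ (suc n) (T j))
      ≡⟨ ∑∑-swapIndex n T ⟩
    ∑ (suc (suc n)) (λ c → ∑ (suc n) (λ l → T (punchIn c l) (swapIndex c l)))
      ≡⟨ ∑-cong (suc (suc n)) (λ c → trans (∑-cong (suc n) (T-swapIndex c)) (∑-neg (suc n) (T c))) ⟩
    ∑ (suc (suc n)) (λ c → - ∑ (suc n) (T c))
      ≡⟨ ∑-neg (suc (suc n)) (λ c → ∑ (suc n) (T c)) ⟩
    - ∑ (suc (suc n)) (λ c → ∑ (suc n) (T c))
      ≡⟨ cong -_ (sym expand) ⟩
    - det (suc (suc n)) (x ∷ x ∷ N) ∎)
    where
    s : ∀ {m} → Fin m → ℤ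
    s j = sign (toℕ j)
    D : Fin (suc (suc n)) → Fin (suc n) → ℤ
    D j l = det n (λ a b → N a (punchIn j (punchIn l b)))
    T : Fin (suc (suc n)) → Fin (suc n) → ℤ
    T j l = s j * (x j * (s l * (x (punchIn j l) * D j l)))

    expand : det (suc (suc n)) (x ∷ x ∷ N) ≡ ∑ (suc (suc n)) (λ j → ∑ (suc n) (T j))
    expand = ∑-cong (suc (suc n)) λ j → begin
      s j * (x j * ∑ (suc n) (λ l → s l * (x (punchIn j l) * D j l)))
        ≡⟨ cong (_*_ (s j)) (sym (∑-distribˡ (suc n) (x j) (λ l → s l * (x (punchIn j l) * D j l)))) ⟩
      s j * ∑ (suc n) (λ l → x j * (s l * (x (punchIn j l) * D j l)))
        ≡⟨ sym (∑-distribˡ (suc n) (s j) (λ l → x j * (s l * (x (punchIn j l) * D j l)))) ⟩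
      ∑ (suc n) (T j) ∎

    regroup : ∀ sP sS sc sl xP xc d → sP * sS ≡ - (sc * sl) →
      sP * (xP * (sS * (xc * d))) ≡ - (sc * (xc * (sl * (xP * d))))
    regroup sP sS sc sl xP xc d eq = begin
      sP * (xP * (sS * (xc * d))) ≡⟨ pull sP sS xP xc d ⟩
      (sP * sS) * (xP * (xc * d)) ≡⟨ cong (λ z → z * (xP * (xc * d))) eq ⟩
      - (sc * sl) * (xP * (xc * d)) ≡⟨ push sc sl xP xc d ⟩
      - (sc * (xc * (sl * (xP * d)))) ∎
      where
      pull : ∀ sP sS xP xc d → sP * (xP * (sS * (xc * d))) ≡ (sP * sS) * (xP * (xc * d))
      pull = solve-∀
      push : ∀ sc sl xP xc d → - (sc * sl) * (xP * (xc * d)) ≡ - (sc * (xc * (sl * (xP * d))))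
      push = solve-∀

    T-swapIndex : ∀ c l → T (punchIn c l) (swapIndex c l) ≡ - T c l
    T-swapIndex c l = trans
      (cong₂ (λ xc d → s (punchIn c l) * (x (punchIn c l) * (s (swapIndex c l) * (xc * d))))
             (cong x (punchIn-swapIndex c l))
             (det-cong n (λ a b → cong (N a) (punchIn²-swapIndex c l b))))
      (regroup (s (punchIn c l)) (s (swapIndex c l)) (s c) (s l) (x (punchIn c l)) (x c) (D c l)
               (sign-swapIndex c l))

  det-swap-rows : ∀ n (x y : Fin (suc (suc n)) → ℤ) (N : Fin n → Fin (suc (suc n)) → ℤ) →
    det (suc (suc n)) (x ∷ y ∷ N) ≡ - det (suc (suc n)) (y ∷ x ∷ N)
  det-swap-rows n x y N = solveFor (begin
    + 0
      ≡⟨ sym (det-repeated-row n z N) ⟩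
    Δ (z ∷ z ∷ N)
      ≡⟨ det-linear-row₀ (suc n) x y (+ 1) (z ∷ N) ⟩
    Δ (x ∷ z ∷ N) + + 1 * Δ (y ∷ z ∷ N)
      ≡⟨ cong₂ (λ a b → a + + 1 * b) (det-linear-row₁ n x x y (+ 1) N) (det-linear-row₁ n y x y (+ 1) N) ⟩
    (Δ (x ∷ x ∷ N) + + 1 * Δ (x ∷ y ∷ N)) + + 1 * (Δ (y ∷ x ∷ N) + + 1 * Δ (y ∷ y ∷ N))
      ≡⟨ cong₂ (λ a b → (a + + 1 * Δ (x ∷ y ∷ N)) + + 1 * (Δ (y ∷ x ∷ N) + + 1 * b))
               (det-repeated-row n x N) (det-repeated-row n y N) ⟩
    (+ 0 + + 1 * Δ (x ∷ y ∷ N)) + + 1 * (Δ (y ∷ x ∷ N) + + 1 * + 0) ∎)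
    where
    Δ : Matrix (suc (suc n)) → ℤ
    Δ = det (suc (suc n))
    z : Fin (suc (suc n)) → ℤ
    z j = x j + + 1 * y j
    solveFor : ∀ {a b} → + 0 ≡ (+ 0 + + 1 * a) + + 1 * (b + + 1 * + 0) → a ≡ - b
    solveFor {a} {b} eq = trans (isolate a b) (trans (cong (_- b) (sym eq)) (+-identityˡ (- b)))
      where
      isolate : ∀ a b → a ≡ ((+ 0 + + 1 * a) + + 1 * (b + + 1 * + 0)) - b
      isolate = solve-∀

  ones : ∀ {n} → Fin n → ℤ
  ones _ = + 1

  det-ones∷ones+δ : ∀ n u (c : Fin (suc (suc n))) (N : Fin n → Fin (suc (suc n)) → ℤ) →
    det (suc (suc n)) (ones ∷ (λ j → ones j + u * δ c j) ∷ N) ≡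
    - (u * (sign (toℕ c) * det (suc n) (ones ∷ (λ a b → N a (punchIn c b)))))
  det-ones∷ones+δ n u c N = begin
    Δ (ones ∷ (λ j → ones j + u * δ c j) ∷ N)
      ≡⟨ det-linear-row₁ n ones ones (δ c) u N ⟩
    Δ (ones ∷ ones ∷ N) + u * Δ (ones ∷ δ c ∷ N)
      ≡⟨ cong₂ (λ a b → a + u * b) (det-repeated-row n ones N) (det-swap-rows n ones (δ c) N) ⟩
    + 0 + u * - Δ (δ c ∷ ones ∷ N)
      ≡⟨ cong (λ d → + 0 + u * - d) (det-unit-row₀ (suc n) c (ones ∷ N)) ⟩
    + 0 + u * - (sign (toℕ c) * det (suc n) (minor (δ c ∷ ones ∷ N) c))
      ≡⟨ cong (λ d → + 0 + u * - (sign (toℕ c) * d)) (det-cong (suc n) minor≗) ⟩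
    + 0 + u * - (sign (toℕ c) * D)
      ≡⟨ simplify u (sign (toℕ c)) D ⟩
    - (u * (sign (toℕ c) * D)) ∎
    where
    Δ : Matrix (suc (suc n)) → ℤ
    Δ = det (suc (suc n))
    D : ℤ
    D = det (suc n) (ones ∷ (λ a b → N a (punchIn c b)))
    minor≗ : ∀ a b → minor (δ c ∷ ones ∷ N) c a b ≡ (ones ∷ (λ a b → N a (punchIn c b))) a b
    minor≗ zero    b = refl
    minor≗ (suc a) b = refl
    simplify : ∀ u s d → + 0 + u * - (s * d) ≡ - (u * (s * d))
    simplify = solve-∀

  det-ones∷J+diag : ∀ k (v : Fin k → ℤ) (M : Matrix (suc k)) →
    (∀ j → M zero j ≡ + 1) → (∀ a j → M (suc a) j ≡ + 1 + v a * δ (suc a) j) →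
    det (suc k) M ≡ ∏ k v
  det-ones∷J+diag zero    v M row₀ rows = cong (λ m → + 1 * (m * + 1) + + 0) (row₀ zero)
  det-ones∷J+diag (suc k) v M row₀ rows = begin
    det (suc (suc k)) M
      ≡⟨ det-cong (suc (suc k)) M≗ ⟩
    det (suc (suc k)) (ones ∷ (λ j → ones j + v zero * δ (suc zero) j) ∷ N)
      ≡⟨ det-ones∷ones+δ k (v zero) (suc zero) N ⟩
    - (v zero * (- + 1 * det (suc k) (ones ∷ (λ a b → N a (punchIn (suc zero) b)))))
      ≡⟨ cong (λ d → - (v zero * (- + 1 * d)))
              (det-ones∷J+diag k (v ∘ suc) (ones ∷ (λ a b → N a (punchIn (suc zero) b))) (λ _ → refl) N-punchIn) ⟩
    - (v zero * (- + 1 * ∏ k (v ∘ suc)))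
      ≡⟨ simplify (v zero) (∏ k (v ∘ suc)) ⟩
    ∏ (suc k) v ∎
    where
    N : Fin k → Fin (suc (suc k)) → ℤ
    N a j = ones j + v (suc a) * δ (suc (suc a)) j
    M≗ : ∀ i j → M i j ≡ (ones ∷ (λ j → ones j + v zero * δ (suc zero) j) ∷ N) i j
    M≗ zero          j = row₀ j
    M≗ (suc zero)    j = rows zero j
    M≗ (suc (suc a)) j = rows (suc a) j
    δ-punchIn : ∀ (a : Fin k) b → δ (suc (suc a)) (punchIn (suc zero) b) ≡ δ (suc a) b
    δ-punchIn a zero    = refl
    δ-punchIn a (suc b) = refl
    N-punchIn : ∀ a b → N a (punchIn (suc zero) b) ≡ + 1 + v (suc a) * δ (suc a) b
    N-punchIn a b = cong (λ e → + 1 + v (suc a) * e) (δ-punchIn a b)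
    simplify : ∀ a b → - (a * (- + 1 * b)) ≡ a * b
    simplify = solve-∀

  det-J+diag : ∀ k (u : Fin k → ℤ) (M : Matrix k) →
    (∀ i j → M i j ≡ + 1 + u i * δ i j) → det k M ≡ symTop k u
  det-J+diag zero    u M entries = refl
  det-J+diag (suc k) u M entries = begin
    det (suc k) M
      ≡⟨ det-cong (suc k) M≗ ⟩
    det (suc k) ((λ j → ones j + u zero * δ zero j) ∷ R)
      ≡⟨ det-linear-row₀ k ones (δ zero) (u zero) R ⟩
    det (suc k) (ones ∷ R) + u zero * det (suc k) (δ zero ∷ R)
      ≡⟨ cong₂ (λ a b → a + u zero * b)
               (det-ones∷J+diag k (u ∘ suc) (ones ∷ R) (λ _ → refl) (λ _ _ → refl))
               (det-unit-row₀ k zero R) ⟩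
    ∏ k (u ∘ suc) + u zero * (+ 1 * det k (λ a b → R a (suc b)))
      ≡⟨ cong (λ d → ∏ k (u ∘ suc) + u zero * (+ 1 * d))
              (det-J+diag k (u ∘ suc) (λ a b → R a (suc b)) (λ _ _ → refl)) ⟩
    ∏ k (u ∘ suc) + u zero * (+ 1 * symTop k (u ∘ suc))
      ≡⟨ simplify (∏ k (u ∘ suc)) (u zero) (symTop k (u ∘ suc)) ⟩
    symTop (suc k) u ∎
    where
    R : Fin k → Fin (suc k) → ℤ
    R a j = ones j + u (suc a) * δ (suc a) j
    M≗ : ∀ i j → M i j ≡ ((λ j → ones j + u zero * δ zero j) ∷ R) i j
    M≗ zero    j = entries zero j
    M≗ (suc a) j = entries (suc a) j
    simplify : ∀ p a b → p + a * (+ 1 * b) ≡ a * b + p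
    simplify = solve-∀

  det-ones∷J+subdiag : ∀ k (v : Fin k → ℤ) (M : Matrix (suc k)) →
    (∀ j → M zero j ≡ + 1) → (∀ a j → M (suc a) j ≡ + 1 + v a * δ (inject₁ a) j) →
    det (suc k) M ≡ sign k * ∏ k v
  det-ones∷J+subdiag zero    v M row₀ rows = cong (λ m → + 1 * (m * + 1) + + 0) (row₀ zero)
  det-ones∷J+subdiag (suc k) v M row₀ rows = begin
    det (suc (suc k)) M
      ≡⟨ det-cong (suc (suc k)) M≗ ⟩
    det (suc (suc k)) (ones ∷ (λ j → ones j + v zero * δ zero j) ∷ N)
      ≡⟨ det-ones∷ones+δ k (v zero) zero N ⟩
    - (v zero * (+ 1 * det (suc k) (ones ∷ (λ a b → N a (suc b)))))
      ≡⟨ cong (λ d → - (v zero * (+ 1 * d)))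
              (det-ones∷J+subdiag k (v ∘ suc) (ones ∷ (λ a b → N a (suc b))) (λ _ → refl) (λ _ _ → refl)) ⟩
    - (v zero * (+ 1 * (sign k * ∏ k (v ∘ suc))))
      ≡⟨ simplify (v zero) (sign k) (∏ k (v ∘ suc)) ⟩
    sign (suc k) * ∏ (suc k) v ∎
    where
    N : Fin k → Fin (suc (suc k)) → ℤ
    N a j = ones j + v (suc a) * δ (inject₁ (suc a)) j
    M≗ : ∀ i j → M i j ≡ (ones ∷ (λ j → ones j + v zero * δ zero j) ∷ N) i j
    M≗ zero          j = row₀ j
    M≗ (suc zero)    j = rows zero j
    M≗ (suc (suc a)) j = rows (suc a) j
    simplify : ∀ a s b → - (a * (+ 1 * (s * b))) ≡ - s * (a * b)
    simplify = solve-∀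

  private
    diag-entry : ∀ a → a ≡ + 1 + (a - + 1) * + 1
    diag-entry = solve-∀
    off-entry : ∀ a → + 1 ≡ + 1 + (a - + 1) * + 0
    off-entry = solve-∀

  AMat-entries : ∀ k p i j → AMat k p i j ≡ + 1 + (+ p i - + 1) * δ i j
  AMat-entries k p i j with i F.≟ j
  ... | yes _ = diag-entry (+ p i)
  ... | no  _ = off-entry (+ p i)

  MMat-entries : ∀ k p i j → MMat k p (suc i) j ≡ + 1 + (+ p i - + 1) * δ (inject₁ i) j
  MMat-entries k p i j with inject₁ i F.≟ j
  ... | yes _ = diag-entry (+ p i)
  ... | no  _ = off-entry (+ p i)

  sign*sign : ∀ k → sign k * sign k ≡ + 1
  sign*sign zero    = refl
  sign*sign (suc k) = trans (neg*neg (sign k)) (sign*sign k)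
    where
    neg*neg : ∀ a → - a * - a ≡ a * a
    neg*neg = solve-∀

  aₖ≡symTop : ∀ k p → aₖ k p ≡ symTop k (λ i → + p i - + 1)
  aₖ≡symTop k p = det-J+diag k (λ i → + p i - + 1) (AMat k p) (AMat-entries k p)

  fₖ≡∏ : ∀ k p → fₖ k p ≡ ∏ k (λ i → + p i - + 1)
  fₖ≡∏ k p = begin
    sign k * det (suc k) (MMat k p)
      ≡⟨ cong (_*_ (sign k)) (det-ones∷J+subdiag k u (MMat k p) (λ _ → refl) (MMat-entries k p)) ⟩
    sign k * (sign k * ∏ k u)  ≡⟨ sym (*-assoc (sign k) (sign k) (∏ k u)) ⟩
    sign k * sign k * ∏ k u    ≡⟨ cong (_* ∏ k u) (sign*sign k) ⟩
    + 1 * ∏ k u                ≡⟨ *-identityˡ (∏ k u) ⟩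
    ∏ k u                      ∎
    where
    u : Fin k → ℤ
    u i = + p i - + 1


module RangeSums where

  open import Data.Nat using (_+_; _*_; _<_)
  import Data.Nat.Properties as ℕ
  open import Algebra.Properties.CommutativeSemigroup ℕ.+-commutativeSemigroup
    using (interchange; x∙yz≈y∙xz)

  sum< : ℕ → (ℕ → ℕ) → ℕ
  sum< zero    f = 0
  sum< (suc N) f = f N + sum< N f

  countRange≡sum< : ∀ N {P : ℕ → Set} (P? : ∀ n → Dec (P n)) →
    countRange N P? ≡ sum< N (λ n → if does (P? (suc n)) then 1 else 0)
  countRange≡sum< zero    P? = refl
  countRange≡sum< (suc N) P? = cong (_+_ (if does (P? (suc N)) then 1 else 0)) (countRange≡sum< N P?)

  sum<-cong : ∀ N {f g : ℕ → ℕ} → (∀ n → n < N → f n ≡ g n) → sum< N f ≡ sum< N g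
  sum<-cong zero    f≗g = refl
  sum<-cong (suc N) f≗g = cong₂ _+_ (f≗g N ℕ.≤-refl) (sum<-cong N (λ n n<N → f≗g n (ℕ.m<n⇒m<1+n n<N)))

  sum<-zero : ∀ N → sum< N (λ _ → 0) ≡ 0
  sum<-zero zero    = refl
  sum<-zero (suc N) = sum<-zero N

  sum<-+ : ∀ N (f g : ℕ → ℕ) → sum< N (λ n → f n + g n) ≡ sum< N f + sum< N g
  sum<-+ zero    f g = refl
  sum<-+ (suc N) f g = trans (cong (_+_ (f N + g N)) (sum<-+ N f g)) (interchange (f N) (g N) (sum< N f) (sum< N g))

  sum<-distribˡ : ∀ N c (f : ℕ → ℕ) → sum< N (λ n → c * f n) ≡ c * sum< N f
  sum<-distribˡ zero    c f = sym (ℕ.*-zeroʳ c)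
  sum<-distribˡ (suc N) c f =
    trans (cong (_+_ (c * f N)) (sum<-distribˡ N c f)) (sym (ℕ.*-distribˡ-+ c (f N) (sum< N f)))

  sum<-+-split : ∀ m N (f : ℕ → ℕ) → sum< (m + N) f ≡ sum< N f + sum< m (λ i → f (N + i))
  sum<-+-split zero    N f = sym (ℕ.+-identityʳ _)
  sum<-+-split (suc m) N f = begin
    f (m + N) + sum< (m + N) f                          ≡⟨ cong₂ _+_ (cong f (ℕ.+-comm m N)) (sum<-+-split m N f) ⟩
    f (N + m) + (sum< N f + sum< m (λ i → f (N + i)))   ≡⟨ x∙yz≈y∙xz (f (N + m)) (sum< N f) _ ⟩
    sum< N f + (f (N + m) + sum< m (λ i → f (N + i)))   ∎

  sum<-blocks : ∀ a b (f : ℕ → ℕ) → sum< (a * b) f ≡ sum< a (λ s → sum< b (λ y → f (y + s * b)))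
  sum<-blocks zero    b f = refl
  sum<-blocks (suc a) b f = begin
    sum< (b + a * b) f                              ≡⟨ sum<-+-split b (a * b) f ⟩
    sum< (a * b) f + sum< b (λ y → f (a * b + y))   ≡⟨ ℕ.+-comm (sum< (a * b) f) _ ⟩
    sum< b (λ y → f (a * b + y)) + sum< (a * b) f   ≡⟨ cong₂ _+_ (sum<-cong b (λ y _ → cong f (ℕ.+-comm (a * b) y)))
                                                                (sum<-blocks a b f) ⟩
    sum< b (λ y → f (y + a * b)) + sum< a (λ s → sum< b (λ y → f (y + s * b))) ∎

  sum<-comm : ∀ a b (F : ℕ → ℕ → ℕ) → sum< a (λ s → sum< b (F s)) ≡ sum< b (λ y → sum< a (λ s → F s y))
  sum<-comm zero    b F = sym (sum<-zero b)
  sum<-comm (suc a) b F =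
    trans (cong (_+_ (sum< b (F a))) (sum<-comm a b F)) (sym (sum<-+ b (F a) (λ y → sum< a (λ s → F s y))))

  sum<-if-none : ∀ a {P : ℕ → Set} (P? : ∀ s → Dec (P s)) X Y → (∀ s → s < a → ¬ P s) →
    sum< a (λ s → if does (P? s) then X else Y) ≡ a * Y
  sum<-if-none zero    P? X Y none = refl
  sum<-if-none (suc a) P? X Y none with P? a
  ... | yes Pa = contradiction Pa (none a ℕ.≤-refl)
  ... | no  _  = cong (_+_ Y) (sum<-if-none a P? X Y (λ s s<a → none s (ℕ.m<n⇒m<1+n s<a)))

  sum<-if-unique : ∀ a {P : ℕ → Set} (P? : ∀ s → Dec (P s)) X Y w → w < suc a → P w →
    (∀ s → s < suc a → P s → s ≡ w) → sum< (suc a) (λ s → if does (P? s) then X else Y) ≡ X + a * Y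
  sum<-if-unique zero    P? X Y zero    _ P0 unique with P? zero
  ... | yes _   = refl
  ... | no  ¬P0 = contradiction P0 ¬P0
  sum<-if-unique zero    P? X Y (suc w) (ℕ.s≤s ()) _ _
  sum<-if-unique (suc a) {P} P? X Y w w<2+a Pw unique with P? (suc a)
  ... | yes Pa = cong (_+_ X) (sum<-if-none (suc a) P? X Y none)
    where
    none : ∀ s → s < suc a → ¬ P s
    none s s<a Ps = ℕ.<⇒≢ s<a (trans (unique s (ℕ.m<n⇒m<1+n s<a) Ps) (sym (unique (suc a) ℕ.≤-refl Pa)))
  ... | no ¬Pa = begin
    Y + sum< (suc a) (λ s → if does (P? s) then X else Y) ≡⟨ cong (_+_ Y) (sum<-if-unique a P? X Y w w<1+a Pw unique′) ⟩
    Y + (X + a * Y)                                        ≡⟨ x∙yz≈y∙xz Y X (a * Y) ⟩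
    X + suc a * Y                                          ∎
    where
    w<1+a : w < suc a
    w<1+a = ℕ.≤∧≢⇒< (ℕ.≤-pred w<2+a) (λ { refl → ¬Pa Pw })
    unique′ : ∀ s → s < suc a → P s → s ≡ w
    unique′ s s<1+a = unique s (ℕ.m<n⇒m<1+n s<1+a)


module Residues where

  open import Data.Nat using (_<_; NonZero)
  import Data.Nat as ℕ
  import Data.Nat.Properties as ℕ
  import Data.Nat.Divisibility as ℕ
  open import Data.Nat.Coprimality using (Coprime; coprime-divisor; coprime-Bézout)
  import Data.Nat.Coprimality as Coprime
  open import Data.Nat.GCD using (module Bézout)
  open import Data.Integer using (_+_; _*_; -_; _-_)
  open import Data.Integer.Properties using (pos-+; pos-*; *-comm; neg-distribˡ-*)
  open import Data.Integer.Tactic.RingSolver using (solve-∀)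
  open import Data.Integer.Divisibility.Signed
    using (_∣_; divides; ∣ᵤ⇒∣; ∣⇒∣ᵤ; ∣m+n∣n⇒∣m; ∣m∣n⇒∣m+n; ∣m∣n⇒∣m-n; ∣n⇒∣m*n)
  open import Data.Integer.DivMod using (_%ℕ_; _/ℕ_; n%ℕd<d; a≡a%ℕn+[a/ℕn]*n)

  coprime-* : ∀ {a m n} → Coprime a m → Coprime a n → Coprime a (m ℕ.* n)
  coprime-* {a} {m} a⊥m a⊥n (d∣a , d∣mn) = a⊥n (d∣a , coprime-divisor d⊥m d∣mn)
    where
    d⊥m : Coprime _ m
    d⊥m (e∣d , e∣m) = a⊥m (ℕ.∣-trans e∣d d∣a , e∣m)

  coprime-prodFin : ∀ k {a} (m : Fin k → ℕ) → (∀ i → Coprime a (m i)) → Coprime a (prodFin k m)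
  coprime-prodFin zero    m a⊥m (_ , d∣1) = ℕ.∣1⇒≡1 d∣1
  coprime-prodFin (suc k) m a⊥m = coprime-* (a⊥m zero) (coprime-prodFin k (m ∘ suc) (a⊥m ∘ suc))

  ∣-prodFin : ∀ k (m : Fin k → ℕ) i → m i ℕ.∣ prodFin k m
  ∣-prodFin (suc k) m zero    = ℕ.m∣m*n (prodFin k (m ∘ suc))
  ∣-prodFin (suc k) m (suc i) = ℕ.∣n⇒∣m*n (m zero) (∣-prodFin k (m ∘ suc) i)

  private
    pos-shift : ∀ n s b r → + (n ℕ.+ s ℕ.* b) - r ≡ (+ n - r) + + s * + b
    pos-shift n s b r = begin
      + (n ℕ.+ s ℕ.* b) - r   ≡⟨ cong (_- r) (trans (pos-+ n (s ℕ.* b)) (cong (_+_ (+ n)) (pos-* s b))) ⟩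
      (+ n + + s * + b) - r   ≡⟨ shift (+ n) (+ s * + b) r ⟩
      (+ n - r) + + s * + b   ∎
      where
      shift : ∀ x y z → (x + y) - z ≡ (x - z) + y
      shift = solve-∀

  ≡[mod]-shift : ∀ {a c} n s r → a ℕ.∣ c → (+ (n ℕ.+ s ℕ.* c)) ≡ r [mod a ] ⇔ (+ n) ≡ r [mod a ]
  ≡[mod]-shift {a} {c} n s r a∣c = mk⇔
    (λ h → ∣⇒∣ᵤ (∣m+n∣n⇒∣m {m = + n - r} (subst (+ a ∣_) (pos-shift n s c r) (∣ᵤ⇒∣ h)) a∣sc))
    (λ h → ∣⇒∣ᵤ (subst (+ a ∣_) (sym (pos-shift n s c r)) (∣m∣n⇒∣m+n (∣ᵤ⇒∣ {i = + n - r} h) a∣sc)))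
    where
    a∣sc : + a ∣ + s * + c
    a∣sc = ∣n⇒∣m*n (+ s) (∣ᵤ⇒∣ a∣c)

  countFin-cong : ∀ k {P Q : Fin k → Set} (P? : ∀ i → Dec (P i)) (Q? : ∀ i → Dec (Q i)) →
    (∀ i → does (P? i) ≡ does (Q? i)) → countFin k P? ≡ countFin k Q?
  countFin-cong zero    P? Q? eq = refl
  countFin-cong (suc k) P? Q? eq =
    cong₂ (λ b c → (if b then 1 else 0) ℕ.+ c) (eq zero) (countFin-cong k (P? ∘ suc) (Q? ∘ suc) (eq ∘ suc))

  γ-periodic : ∀ k m r n s → γ k m r (n ℕ.+ s ℕ.* prodFin k m) ≡ γ k m r n
  γ-periodic k m r n s = countFin-cong k _ _ λ i →
    does-⇔ (≡[mod]-shift n s (r i) (∣-prodFin k m i))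
           ((+ (n ℕ.+ s ℕ.* prodFin k m)) ≡? r i [mod m i ]) ((+ n) ≡? r i [mod m i ])

  private
    pos-identity : ∀ d x y m n → d ℕ.+ y ℕ.* n ≡ x ℕ.* m → + d + + y * + n ≡ + x * + m
    pos-identity d x y m n eq = begin
      + d + + y * + n       ≡⟨ cong (_+_ (+ d)) (pos-* y n) ⟨
      + d + + (y ℕ.* n)     ≡⟨ pos-+ d (y ℕ.* n) ⟨
      + (d ℕ.+ y ℕ.* n)     ≡⟨ cong +_ eq ⟩
      + (x ℕ.* m)           ≡⟨ pos-* x m ⟩
      + x * + m             ∎

  ∃-inverse-mod : ∀ {a b} → Coprime a b → ∃ λ t → + a ∣ + b * t - + 1
  ∃-inverse-mod {a} {b} a⊥b with coprime-Bézout (Coprime.sym a⊥b)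
  ... | Bézout.+- x y eq = + x , divides (+ y) (begin
    + b * + x - + 1       ≡⟨ cong (_- + 1) (trans (*-comm (+ b) (+ x)) (sym (pos-identity 1 x y b a eq))) ⟩
    + 1 + + y * + a - + 1 ≡⟨ cancel (+ y * + a) ⟩
    + y * + a             ∎)
    where
    cancel : ∀ u → + 1 + u - + 1 ≡ u
    cancel = solve-∀
  ... | Bézout.-+ x y eq = - + x , divides (- + y) (begin
    + b * - + x - + 1     ≡⟨ negate (+ b) (+ x) ⟩
    - (+ 1 + + x * + b)   ≡⟨ cong -_ (pos-identity 1 y x a b eq) ⟩
    - (+ y * + a)         ≡⟨ neg-distribˡ-* (+ y) (+ a) ⟩
    - + y * + a           ∎)
    where
    negate : ∀ b x → b * - x - + 1 ≡ - (+ 1 + x * b)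
    negate = solve-∀

  module Hits {a b : ℕ} .{{_ : NonZero a}} (a⊥b : Coprime a b) (n : ℕ) (r : ℤ) where

    Hit : ℕ → Set
    Hit s = (+ (n ℕ.+ s ℕ.* b)) ≡ r [mod a ]

    -- With b t ≡ 1 (mod a), the hit is s = −(n − r) t reduced mod a.
    hit-exists : ∃ λ w → w < a × Hit w
    hit-exists with ∃-inverse-mod a⊥b
    ... | t , divides q bt-1≡qa = c %ℕ a , n%ℕd<d c a , ∣⇒∣ᵤ (divides W (begin
      + (n ℕ.+ w ℕ.* b) - r                ≡⟨ pos-shift n w b r ⟩
      z + + w * + b                        ≡⟨ unfold z (+ w) k (+ a) (+ b) ⟩
      z + ((+ w + k * + a) - k * + a) * + b ≡⟨ cong (λ e → z + (e - k * + a) * + b) (a≡a%ℕn+[a/ℕn]*n c a) ⟨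
      z + (c - k * + a) * + b              ≡⟨ regroup z t k (+ a) (+ b) ⟩
      - z * (+ b * t - + 1) - k * + b * + a ≡⟨ cong (λ e → - z * e - k * + b * + a) bt-1≡qa ⟩
      - z * (q * + a) - k * + b * + a      ≡⟨ factor z q k (+ a) (+ b) ⟩
      W * + a                              ∎))
      where
      z c W k : ℤ
      z = + n - r
      c = - z * t
      k = c /ℕ a
      W = - z * q - k * + b
      w : ℕ
      w = c %ℕ a
      unfold : ∀ z w k a b → z + w * b ≡ z + ((w + k * a) - k * a) * b
      unfold = solve-∀
      regroup : ∀ z t k a b → z + (- z * t - k * a) * b ≡ - z * (b * t - + 1) - k * b * a
      regroup = solve-∀
      factor : ∀ z q k a b → - z * (q * a) - k * b * a ≡ (- z * q - k * b) * a
      factor = solve-∀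

    ∣∧<⇒≡0 : ∀ {d} → a ℕ.∣ d → d < a → d ≡ 0
    ∣∧<⇒≡0 {zero}  _   _   = refl
    ∣∧<⇒≡0 {suc d} a∣d d<a = contradiction (ℕ.∣⇒≤ a∣d) (ℕ.<⇒≱ d<a)

    hit-unique-≤ : ∀ {s s′} → s ℕ.≤ s′ → s′ < a → Hit s → Hit s′ → s ≡ s′
    hit-unique-≤ {s} {s′} s≤s′ s′<a hit hit′ = begin
      s          ≡⟨ ℕ.+-identityʳ s ⟨
      s ℕ.+ 0    ≡⟨ cong (s ℕ.+_) (∣∧<⇒≡0 a∣d (ℕ.≤-<-trans (ℕ.m∸n≤m s′ s) s′<a)) ⟨
      s ℕ.+ d    ≡⟨ ℕ.m+[n∸m]≡n s≤s′ ⟩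
      s′         ∎
      where
      d : ℕ
      d = s′ ℕ.∸ s
      z : ℤ
      z = + n - r
      hit-d : + a ∣ z + + (s ℕ.+ d) * + b
      hit-d = subst (λ e → + a ∣ z + + e * + b) (sym (ℕ.m+[n∸m]≡n s≤s′))
                    (subst (+ a ∣_) (pos-shift n s′ b r) (∣ᵤ⇒∣ hit′))
      difference : (z + + (s ℕ.+ d) * + b) - (z + + s * + b) ≡ + (b ℕ.* d)
      difference = begin
        (z + + (s ℕ.+ d) * + b) - (z + + s * + b) ≡⟨ cong (λ e → (z + e * + b) - (z + + s * + b)) (pos-+ s d) ⟩
        (z + (+ s + + d) * + b) - (z + + s * + b) ≡⟨ cancel z (+ s) (+ d) (+ b) ⟩
        + b * + d                                 ≡⟨ pos-* b d ⟨
        + (b ℕ.* d)                               ∎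
        where
        cancel : ∀ z s d b → (z + (s + d) * b) - (z + s * b) ≡ b * d
        cancel = solve-∀
      a∣d : a ℕ.∣ d
      a∣d = coprime-divisor a⊥b (∣⇒∣ᵤ (subst (+ a ∣_) difference
              (∣m∣n⇒∣m-n hit-d (subst (+ a ∣_) (pos-shift n s b r) (∣ᵤ⇒∣ hit)))))

    hit-unique : ∀ {s s′} → s < a → s′ < a → Hit s → Hit s′ → s ≡ s′
    hit-unique {s} {s′} s<a s′<a hit hit′ with ℕ.≤-total s s′
    ... | inj₁ s≤s′ = hit-unique-≤ s≤s′ s′<a hit hit′
    ... | inj₂ s′≤s = sym (hit-unique-≤ s′≤s s<a hit′ hit)


module Counting where

  open RangeSums
  open Residues
  open import Data.Nat using (_+_; _*_; _<_; pred; NonZero)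
  import Data.Nat as ℕ
  open import Data.Nat.Coprimality using (Coprime)
  open import Data.Integer using (_-_)
  open import Data.Integer.Properties using (pos-+; pos-*; +-comm)

  sum<-by-residue : ∀ {a} b .{{_ : NonZero a}} → Coprime a b → (r : ℤ) (g : ℕ → ℕ) →
    (∀ y s → g (y + s * b) ≡ g y) → (X Y : ℕ → ℕ) →
    sum< (a * b) (λ n → if does ((+ suc n) ≡? r [mod a ]) then X (g n) else Y (g n)) ≡
    sum< b (X ∘ g) + pred a * sum< b (Y ∘ g)
  sum<-by-residue {suc a} b a⊥b r g g-periodic X Y = begin
    sum< (suc a * b) F                                     ≡⟨ sum<-blocks (suc a) b F ⟩
    sum< (suc a) (λ s → sum< b (λ y → F (y + s * b)))      ≡⟨ sum<-comm (suc a) b (λ s y → F (y + s * b)) ⟩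
    sum< b (λ y → sum< (suc a) (λ s → F (y + s * b)))      ≡⟨ sum<-cong b (λ y _ → fibre y) ⟩
    sum< b (λ y → X (g y) + a * Y (g y))                   ≡⟨ sum<-+ b (X ∘ g) (λ y → a * Y (g y)) ⟩
    sum< b (X ∘ g) + sum< b (λ y → a * Y (g y))            ≡⟨ cong (_+_ (sum< b (X ∘ g))) (sum<-distribˡ b a (Y ∘ g)) ⟩
    sum< b (X ∘ g) + a * sum< b (Y ∘ g)                    ∎
    where
    F : ℕ → ℕ
    F n = if does ((+ suc n) ≡? r [mod suc a ]) then X (g n) else Y (g n)
    fibre : ∀ y → sum< (suc a) (λ s → F (y + s * b)) ≡ X (g y) + a * Y (g y)
    fibre y = trans
      (sum<-cong (suc a) (λ s _ → cong (λ c → if does (hit? s) then X c else Y c) (g-periodic y s)))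
      (sum<-if-unique a hit? (X (g y)) (Y (g y)) w w<a hit (λ s s<a hit′ → hit-unique s<a w<a hit′ hit))
      where
      open Hits a⊥b (suc y) r
      hit? : ∀ s → Dec (Hit s)
      hit? s = (+ suc (y + s * b)) ≡? r [mod suc a ]
      w : ℕ
      w = proj₁ hit-exists
      w<a : w < suc a
      w<a = proj₁ (proj₂ hit-exists)
      hit : Hit w
      hit = proj₂ (proj₂ hit-exists)

  indicator : ∀ {P : Set} → Dec P → ℕ
  indicator P? = if does P? then 1 else 0

  #available #free : ∀ k → (Fin k → ℕ) → (Fin k → ℤ) → ℕ
  #available k m r = countRange (prodFin k m) (λ n → γ k m r n ≤? 1)
  #free      k m r = countRange (prodFin k m) (λ n → γ k m r n ≟ 0)

  private
    available-step : ∀ B c →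
      indicator ((if B then 1 else 0) + c ≤? 1) ≡ (if B then indicator (c ≟ 0) else indicator (c ≤? 1))
    available-step false c       = refl
    available-step true  zero    = refl
    available-step true  (suc c) = refl

    free-step : ∀ B c → indicator ((if B then 1 else 0) + c ≟ 0) ≡ (if B then 0 else indicator (c ≟ 0))
    free-step false c = refl
    free-step true  c = refl

  module _ (k : ℕ) (m : Fin (suc k) → ℕ) .{{_ : NonZero (m zero)}} (r : Fin (suc k) → ℤ)
           (m₀⊥ : Coprime (m zero) (prodFin k (m ∘ suc))) where

    private
      b : ℕ
      b = prodFin k (m ∘ suc)
      g : ℕ → ℕ
      g n = γ k (m ∘ suc) (r ∘ suc) (suc n)
      hit₀? : ∀ n → Dec ((+ suc n) ≡ r zero [mod m zero ])
      hit₀? n = (+ suc n) ≡? r zero [mod m zero ]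
      residue : ∀ X Y → sum< (m zero * b) (λ n → if does (hit₀? n) then X (g n) else Y (g n)) ≡
                        sum< b (X ∘ g) + pred (m zero) * sum< b (Y ∘ g)
      residue = sum<-by-residue b m₀⊥ (r zero) g (λ y s → γ-periodic k (m ∘ suc) (r ∘ suc) (suc y) s)

    #available-suc :
      #available (suc k) m r ≡ #free k (m ∘ suc) (r ∘ suc) + pred (m zero) * #available k (m ∘ suc) (r ∘ suc)
    #available-suc = begin
      #available (suc k) m r
        ≡⟨ countRange≡sum< (m zero * b) (λ n → γ (suc k) m r n ≤? 1) ⟩
      sum< (m zero * b) (λ n → indicator (γ (suc k) m r (suc n) ≤? 1))
        ≡⟨ sum<-cong (m zero * b) (λ n _ → available-step (does (hit₀? n)) (g n)) ⟩
      sum< (m zero * b) (λ n → if does (hit₀? n) then indicator (g n ≟ 0) else indicator (g n ≤? 1))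
        ≡⟨ residue (λ c → indicator (c ≟ 0)) (λ c → indicator (c ≤? 1)) ⟩
      sum< b (λ n → indicator (g n ≟ 0)) + pred (m zero) * sum< b (λ n → indicator (g n ≤? 1))
        ≡⟨ cong₂ (λ F A → F + pred (m zero) * A)
                 (countRange≡sum< b (λ n → γ k (m ∘ suc) (r ∘ suc) n ≟ 0))
                 (countRange≡sum< b (λ n → γ k (m ∘ suc) (r ∘ suc) n ≤? 1)) ⟨
      #free k (m ∘ suc) (r ∘ suc) + pred (m zero) * #available k (m ∘ suc) (r ∘ suc) ∎

    #free-suc : #free (suc k) m r ≡ pred (m zero) * #free k (m ∘ suc) (r ∘ suc)
    #free-suc = begin
      #free (suc k) m r
        ≡⟨ countRange≡sum< (m zero * b) (λ n → γ (suc k) m r n ≟ 0) ⟩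
      sum< (m zero * b) (λ n → indicator (γ (suc k) m r (suc n) ≟ 0))
        ≡⟨ sum<-cong (m zero * b) (λ n _ → free-step (does (hit₀? n)) (g n)) ⟩
      sum< (m zero * b) (λ n → if does (hit₀? n) then 0 else indicator (g n ≟ 0))
        ≡⟨ residue (λ _ → 0) (λ c → indicator (c ≟ 0)) ⟩
      sum< b (λ _ → 0) + pred (m zero) * sum< b (λ n → indicator (g n ≟ 0))
        ≡⟨ cong₂ (λ Z F → Z + pred (m zero) * F) (sym (sum<-zero b))
                 (countRange≡sum< b (λ n → γ k (m ∘ suc) (r ∘ suc) n ≟ 0)) ⟨
      pred (m zero) * #free k (m ∘ suc) (r ∘ suc) ∎

  private
    pos-pred : ∀ a .{{_ : NonZero a}} → + pred a ≡ + a - + 1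
    pos-pred (suc a) = refl

  count-available-free : ∀ k (m : Fin k → ℕ) → (∀ i → NonZero (m i)) →
    (∀ i j → toℕ i < toℕ j → Coprime (m i) (m j)) → (r : Fin k → ℤ) →
    (+ #available k m r ≡ symTop k (λ i → + m i - + 1)) × (+ #free k m r ≡ ∏ k (λ i → + m i - + 1))
  count-available-free zero    m nonZero m⊥ r = refl , refl
  count-available-free (suc k) m nonZero m⊥ r = available , free
    where
    u : Fin (suc k) → ℤ
    u i = + m i - + 1
    A F : ℕ
    A = #available k (m ∘ suc) (r ∘ suc)
    F = #free k (m ∘ suc) (r ∘ suc)
    IH : (+ A ≡ symTop k (u ∘ suc)) × (+ F ≡ ∏ k (u ∘ suc))
    IH = count-available-free k (m ∘ suc) (nonZero ∘ suc)
           (λ i j i<j → m⊥ (suc i) (suc j) (ℕ.s≤s i<j)) (r ∘ suc)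
    m₀⊥ : Coprime (m zero) (prodFin k (m ∘ suc))
    m₀⊥ = coprime-prodFin k (m ∘ suc) (λ i → m⊥ zero (suc i) (ℕ.s≤s ℕ.z≤n))
    u₀ : + pred (m zero) ≡ u zero
    u₀ = pos-pred (m zero) {{nonZero zero}}

    available : + #available (suc k) m r ≡ symTop (suc k) u
    available = begin
      + #available (suc k) m r               ≡⟨ cong +_ (#available-suc k m {{nonZero zero}} r m₀⊥) ⟩
      + (F + pred (m zero) * A)              ≡⟨ trans (pos-+ F _) (cong (ℤ._+_ (+ F)) (pos-* (pred (m zero)) A)) ⟩
      + F ℤ.+ + pred (m zero) ℤ.* + A        ≡⟨ cong₂ (λ f a → f ℤ.+ a) (proj₂ IH) (cong₂ ℤ._*_ u₀ (proj₁ IH)) ⟩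
      ∏ k (u ∘ suc) ℤ.+ u zero ℤ.* symTop k (u ∘ suc) ≡⟨ +-comm (∏ k (u ∘ suc)) _ ⟩
      symTop (suc k) u                       ∎

    free : + #free (suc k) m r ≡ ∏ (suc k) u
    free = begin
      + #free (suc k) m r                    ≡⟨ cong +_ (#free-suc k m {{nonZero zero}} r m₀⊥) ⟩
      + (pred (m zero) * F)                  ≡⟨ pos-* (pred (m zero)) F ⟩
      + pred (m zero) ℤ.* + F                ≡⟨ cong₂ ℤ._*_ u₀ (proj₂ IH) ⟩
      ∏ (suc k) u                            ∎

open DeterminantFormulas using (aₖ≡symTop; fₖ≡∏)
open Counting using (#available; #free; count-available-free)

theorem1 : (k : ℕ) → 1 ≤ k → (p : Fin k → ℕ) → FirstPrimes k p →
    (r : Fin k → ℤ) →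
    (+ countRange (prodFin k p) (λ n → γ k p r n ≤? 1) ≡ aₖ k p) ×
    (+ countRange (prodFin k p) (λ n → γ k p r n ≟ 0) ≡ fₖ k p)
theorem1 k _ p (prime , increasing , _) r =
  trans (proj₁ counts) (sym (aₖ≡symTop k p)) , trans (proj₂ counts) (sym (fₖ≡∏ k p))
  where
  p⊥p : ∀ i j → toℕ i ℕ.< toℕ j → Coprime.Coprime (p i) (p j)
  p⊥p i j i<j = Coprime.sym (prime⇒coprime (prime j) {{prime⇒nonZero (prime i)}} (increasing i j i<j))
  counts : (+ #available k p r ≡ symTop k (λ i → + p i ℤ.- + 1)) × (+ #free k p r ≡ ∏ k (λ i → + p i ℤ.- + 1))
  counts = count-available-free k p (prime⇒nonZero ∘ prime) p⊥p r
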